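{- The following statement is valid in the internal language of the effective topos $\mathsf{Eff}$: for all $\phi,\psi:\nabla\mathsf{2}\to\Omega$, if $\forall p\in\nabla\mathsf{2}.\ (\phi(p)\vee\psi(p))$, then $(\forall p\in\nabla\mathsf{2}.\ \phi(p))\vee(\forall p\in\nabla\mathsf{2}.\ \psi(p))$.
   Context: $\mathsf{Eff}$ is Hyland's effective topos with subobject classifier $\Omega$. $\mathsf{2}=\{0,1\}$ and $\nabla:\mathsf{Set}\to\mathsf{Eff}$ sends a set $T$ to the object with underlying set $T$ and equality predicate $[x=y]=\mathbb{N}$ if $x=y$ and $\emptyset$ otherwise. -}

module Defs where

open import Data.Nat using (ℕ; zero; suc; _+_; _*_; _<_)
open import Data.Nat.DivMod using (_/_)
open import Data.Fin using (Fin; toℕ)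
open import Data.Vec using (Vec; []; _∷_; lookup)
open import Data.Bool using (Bool; false; true)
open import Data.Product using (Σ; Σ-syntax; _×_; _,_)
open import Data.Sum using (_⊎_)
open import Relation.Binary.PropositionalEquality using (_≡_)

-- Kleene's first algebra K1 (partial recursive application on ℕ)

⟨_,_⟩ : ℕ → ℕ → ℕ
⟨ x , y ⟩ = ((x + y) * suc (x + y)) / 2 + y

-- codes of μ-recursive functions of arity n
data Code : ℕ → Set where
  zer  : ∀ {n} → Code n
  succ : Code 1
  proj : ∀ {n} → Fin n → Code n
  comp : ∀ {m n} → Code m → Vec (Code n) m → Code n
  prec : ∀ {n} → Code n → Code (suc (suc n)) → Code (suc n)
  mu   : ∀ {n} → Code (suc n) → Code n

mutual
  encode : ∀ {n} → Code n → ℕ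
  encode (zer {n})        = ⟨ 0 , n ⟩
  encode succ             = ⟨ 1 , 0 ⟩
  encode (proj {n} i)     = ⟨ 2 , ⟨ n , toℕ i ⟩ ⟩
  encode (comp {m} {n} f gs) = ⟨ 3 , ⟨ n , ⟨ m , ⟨ encode f , encodeVec gs ⟩ ⟩ ⟩ ⟩
  encode (prec f g)       = ⟨ 4 , ⟨ encode f , encode g ⟩ ⟩
  encode (mu f)           = ⟨ 5 , encode f ⟩

  encodeVec : ∀ {m n} → Vec (Code n) m → ℕ
  encodeVec []       = 0
  encodeVec (g ∷ gs) = suc ⟨ encode g , encodeVec gs ⟩

-- big-step semantics (partial): Eval f xs y  means  f(xs) ↓ = y
mutual
  data Eval : ∀ {n} → Code n → Vec ℕ n → ℕ → Set where
    ev-zer  : ∀ {n} {xs : Vec ℕ n} → Eval zer xs 0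
    ev-succ : ∀ {x} → Eval succ (x ∷ []) (suc x)
    ev-proj : ∀ {n} {i : Fin n} {xs} → Eval (proj i) xs (lookup xs i)
    ev-comp : ∀ {m n} {f : Code m} {gs : Vec (Code n) m} {xs ys z} →
              EvalVec gs xs ys → Eval f ys z → Eval (comp f gs) xs z
    ev-prec0 : ∀ {n} {f : Code n} {g} {xs z} →
               Eval f xs z → Eval (prec f g) (0 ∷ xs) z
    ev-precS : ∀ {n} {f : Code n} {g} {k xs r z} →
               Eval (prec f g) (k ∷ xs) r → Eval g (k ∷ r ∷ xs) z →
               Eval (prec f g) (suc k ∷ xs) z
    ev-mu : ∀ {n} {f : Code (suc n)} {xs y} →
            Eval f (y ∷ xs) 0 →
            (∀ z → z < y → Σ[ w ∈ ℕ ] Eval f (z ∷ xs) (suc w)) →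
            Eval (mu f) xs y

  data EvalVec : ∀ {m n} → Vec (Code n) m → Vec ℕ n → Vec ℕ m → Set where
    ev-[] : ∀ {n} {xs : Vec ℕ n} → EvalVec [] xs []
    ev-∷  : ∀ {m n} {g : Code n} {gs : Vec (Code n) m} {xs y ys} →
            Eval g xs y → EvalVec gs xs ys → EvalVec (g ∷ gs) xs (y ∷ ys)

_·_≃_ : ℕ → ℕ → ℕ → Set
e · a ≃ b = Σ[ c ∈ Code 1 ] (encode c ≡ e × Eval c (a ∷ []) b)

-- truth values of Eff: subsets of ℕ (sets of realizers)
Ω : Set₁
Ω = ℕ → Set

-- underlying set of ∇2 (every element has existence predicate ℕ)
∇2 : Set
∇2 = Bool

_∨_ : Ω → Ω → Ω
(A ∨ B) n = (Σ[ a ∈ ℕ ] (n ≡ ⟨ 0 , a ⟩ × A a)) ⊎ (Σ[ b ∈ ℕ ] (n ≡ ⟨ 1 , b ⟩ × B b))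

_⇒_ : Ω → Ω → Ω
(A ⇒ B) e = ∀ a → A a → Σ[ b ∈ ℕ ] (e · a ≃ b × B b)

-- n ⊩ ∀ p ∈ ∇2. φ(p)   (∇-objects: intersection over the underlying set)
All∇2 : (∇2 → Ω) → Ω
All∇2 φ n = ∀ p → φ p n

-- validity of a closed statement: it has a realizer
-- (closed statements quantifying over Ω^∇2 have realizer sets in Set₁)
Valid : (ℕ → Set₁) → Set₁
Valid A = Σ[ e ∈ ℕ ] A e

AllPred2 : ((∇2 → Ω) → (∇2 → Ω) → Ω) → ℕ → Set₁
AllPred2 Θ n = ∀ φ ψ → Θ φ ψ n

module Submission where

-- A realizer of  ∀ p ∈ ∇2. φ(p) ∨ ψ(p)  is a single number n that realizes
-- φ(p) ∨ ψ(p) for BOTH values of p, because quantification over a ∇-object is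
-- an intersection of realizer sets.  A realizer of a disjunction is a Cantor
-- pair ⟨ tag , payload ⟩, and Cantor pairing is injective, so both instances
-- share one tag and one payload: n = ⟨ 0 , a ⟩ with a realizing every φ(p), or
-- n = ⟨ 1 , b ⟩ with b realizing every ψ(p).  Hence n itself already realizes
-- (∀p. φ(p)) ∨ (∀p. ψ(p)), and the identity function is a uniform realizer.

open import Defs
open import Data.Nat using (ℕ; zero; suc; _+_; _*_; _<_; _≤_; z≤n; s≤s)
open import Data.Nat.Properties
open import Data.Nat.DivMod using (_/_; m*n/n≡m)
open import Data.Nat.Tactic.RingSolver using (solve-∀)
open import Data.Fin using () renaming (zero to fzero)
open import Data.Product using (_×_; _,_; proj₁; proj₂)
open import Data.Sum using (inj₁; inj₂)
open import Data.Bool using (true)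
open import Data.Empty using (⊥-elim)
open import Relation.Binary.PropositionalEquality
open import Relation.Binary.Definitions using (tri<; tri≈; tri>)

triangle : ℕ → ℕ
triangle zero    = 0
triangle (suc s) = triangle s + suc s

-- Gauss' formula, in the division-free form  2 · T s = s (s + 1).
triangle-double : ∀ s → triangle s * 2 ≡ s * suc s
triangle-double zero    = refl
triangle-double (suc s) = begin
  (triangle s + suc s) * 2       ≡⟨ *-distribʳ-+ 2 (triangle s) (suc s) ⟩
  triangle s * 2 + suc s * 2     ≡⟨ cong (_+ suc s * 2) (triangle-double s) ⟩
  s * suc s + suc s * 2          ≡⟨ gauss-step s ⟩
  suc s * suc (suc s)            ∎
  where
  open ≡-Reasoning
  gauss-step : ∀ s → s * suc s + suc s * 2 ≡ suc s * suc (suc s)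
  gauss-step = solve-∀

pairing-triangle : ∀ x y → ⟨ x , y ⟩ ≡ triangle (x + y) + y
pairing-triangle x y = cong (_+ y) (begin
  (s * suc s) / 2            ≡⟨ cong (_/ 2) (sym (triangle-double s)) ⟩
  (triangle s * 2) / 2       ≡⟨ m*n/n≡m (triangle s) 2 ⟩
  triangle s                 ∎)
  where
  open ≡-Reasoning
  s : ℕ
  s = x + y

triangle-mono : ∀ {s t} → s ≤ t → triangle s ≤ triangle t
triangle-mono {t = t} z≤n = z≤n
triangle-mono (s≤s s≤t) = +-mono-≤ (triangle-mono s≤t) (s≤s s≤t)

diagonal-below : ∀ {s t y y′} → y ≤ s → s < t → triangle s + y < triangle t + y′
diagonal-below {s} {t} {y} {y′} y≤s s<t = begin-strict
  triangle s + y       <⟨ +-monoʳ-< (triangle s) (s≤s y≤s) ⟩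
  triangle (suc s)     ≤⟨ triangle-mono s<t ⟩
  triangle t           ≤⟨ m≤m+n (triangle t) y′ ⟩
  triangle t + y′      ∎
  where open ≤-Reasoning

diagonal-unique : ∀ {s t y y′} → y ≤ s → y′ ≤ t →
                  triangle s + y ≡ triangle t + y′ → s ≡ t × y ≡ y′
diagonal-unique {s} {t} y≤s y′≤t eq with <-cmp s t
... | tri< s<t _ _ = ⊥-elim (<⇒≢ (diagonal-below y≤s s<t) eq)
... | tri> _ _ t<s = ⊥-elim (<⇒≢ (diagonal-below y′≤t t<s) (sym eq))
... | tri≈ _ refl _ = refl , +-cancelˡ-≡ (triangle s) _ _ eq

pairing-injective : ∀ x y x′ y′ → ⟨ x , y ⟩ ≡ ⟨ x′ , y′ ⟩ → x ≡ x′ × y ≡ y′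
pairing-injective x y x′ y′ eq =
  +-cancelʳ-≡ y x x′ (trans diag (cong (x′ +_) (sym pos))) , pos
  where
  unpaired : triangle (x + y) + y ≡ triangle (x′ + y′) + y′
  unpaired = trans (sym (pairing-triangle x y)) (trans eq (pairing-triangle x′ y′))
  diag : x + y ≡ x′ + y′
  diag = proj₁ (diagonal-unique (m≤n+m y x) (m≤n+m y′ x′) unpaired)
  pos : y ≡ y′
  pos = proj₂ (diagonal-unique (m≤n+m y x) (m≤n+m y′ x′) unpaired)

∨-left : ∀ {A B : Ω} {a} → (A ∨ B) ⟨ 0 , a ⟩ → A a
∨-left {A} {a = a} (inj₁ (a′ , eq , x)) = subst A (sym (proj₂ (pairing-injective 0 a 0 a′ eq))) x
∨-left     {a = a} (inj₂ (b  , eq , _)) with () ← proj₁ (pairing-injective 0 a 1 b eq)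

∨-right : ∀ {A B : Ω} {b} → (A ∨ B) ⟨ 1 , b ⟩ → B b
∨-right         {b = b} (inj₁ (a  , eq , _)) with () ← proj₁ (pairing-injective 1 b 0 a eq)
∨-right {B = B} {b = b} (inj₂ (b′ , eq , y)) = subst B (sym (proj₂ (pairing-injective 1 b 1 b′ eq))) y

-- Uniformity of disjunction: over an inhabited index set I, a common realizer
-- of all φ i ∨ ψ i realizes (⋂ᵢ φ i) ∨ (⋂ᵢ ψ i).  The witness i₀ decides the side.
∨-uniform : ∀ {I : Set} → I → (φ ψ : I → Ω) → ∀ n → (∀ i → (φ i ∨ ψ i) n) →
            ((λ m → ∀ i → φ i m) ∨ (λ m → ∀ i → ψ i m)) n
∨-uniform i₀ φ ψ n r with r i₀
... | inj₁ (a , refl , _) = inj₁ (a , refl , λ i → ∨-left (r i))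
... | inj₂ (b , refl , _) = inj₂ (b , refl , λ i → ∨-right (r i))

identity : Code 1
identity = proj fzero

identity-realizes : ∀ {A B : Ω} → (∀ n → A n → B n) → (A ⇒ B) (encode identity)
identity-realizes A⊆B n a = n , (identity , refl , ev-proj) , A⊆B n a

mainTheorem5 : Valid (AllPred2 (λ φ ψ → All∇2 (λ p → φ p ∨ ψ p) ⇒ (All∇2 φ ∨ All∇2 ψ)))
mainTheorem5 = encode identity , λ φ ψ → identity-realizes (∨-uniform true φ ψ)
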